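{- Let $G$ be a directed acyclic graph, $s,v\in V(G)$, and let $\mathcal{P}_v$ be the set of all directed paths from $s$ to $v$ in $G$. Let $S\subseteq E(G)$ and let $P\in\mathcal{P}_v$ be such that all edges of $S$ lie on $P$. Let $e_1,\dots,e_k$ be the edges of $S$ in the order in which they appear on $P$, write $e_i=(t_i,s_i)$ for $1\le i\le k$, and set $s_0=s$ and $t_{k+1}=v$. Then $S$ is a forcing set for $P$ (with respect to $\mathcal{P}_v$) if and only if $s_i\Rightarrow t_{i+1}$ for all $0\le i\le k$.
   Context: For vertices $x,y$, write $x\Rightarrow y$ if there is exactly one directed path from $x$ to $y$ in $G$ (in particular $x\Rightarrow x$ for every $x$). $S$ is a forcing set for $P$ with respect to $\mathcal{P}_v$ if $S\subseteq E(P)$ and no $P'\in\mathcal{P}_v$ with $P'\neq P$ satisfies $S\subseteq E(P')$. -}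

module Defs where

open import Data.Nat using (ℕ)
open import Data.Fin using (Fin)
open import Data.Bool using (Bool; T)
open import Data.List using (List; []; _∷_)
open import Data.List.Relation.Unary.Unique.Propositional using (Unique)
open import Data.List.Relation.Unary.All using (All)
open import Data.List.Membership.Propositional using (_∈_)
open import Data.List.Relation.Binary.Sublist.Propositional using (_⊆_)
open import Data.Product using (_×_; _,_; Σ)
open import Data.Empty using (⊥)
open import Relation.Binary.PropositionalEquality using (_≡_)
open import Relation.Nullary using (¬_)

Graph : ℕ → Set
Graph n = Fin n → Fin n → Bool

-- An edge is an ordered pair (tail , head).
Edge : ℕ → Set
Edge n = Fin n × Fin n

module _ {n : ℕ} (G : Graph n) where

  data Walk : Fin n → Fin n → List (Fin n) → Set where
    here : ∀ {x} → Walk x x (x ∷ [])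
    step : ∀ {x y z vs} → T (G x y) → Walk y z vs → Walk x z (x ∷ vs)

  DPath : Fin n → Fin n → List (Fin n) → Set
  DPath x y vs = Walk x y vs × Unique vs

  Acyclic : Set
  Acyclic = ∀ x y vs → T (G x y) → Walk y x vs → ⊥

  _⇒_ : Fin n → Fin n → Set
  x ⇒ y = Σ (List (Fin n)) λ vs → DPath x y vs × (∀ ws → DPath x y ws → ws ≡ vs)

edges : ∀ {n} → List (Fin n) → List (Edge n)
edges [] = []
edges (x ∷ []) = []
edges (x ∷ y ∷ vs) = (x , y) ∷ edges (y ∷ vs)

EdgesOn : ∀ {n} → List (Edge n) → List (Fin n) → Set
EdgesOn S P = All (_∈ edges P) S

Forcing : ∀ {n} → Graph n → Fin n → Fin n → List (Edge n) → List (Fin n) → Set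
Forcing G s v S P =
  EdgesOn S P × (∀ P' → DPath G s v P' → ¬ (P' ≡ P) → ¬ EdgesOn S P')

-- Chain G x [e₁,…,e_k] v  :=  x ⇒ t₁, s₁ ⇒ t₂, …, s_k ⇒ v, where eᵢ = (tᵢ , sᵢ).
Chain : ∀ {n} → Graph n → Fin n → List (Edge n) → Fin n → Set
Chain G x [] v = _⇒_ G x v
Chain G x ((t , s') ∷ es) v = _⇒_ G x t × Chain G s' es v

-- In an acyclic graph every walk is a path, so forcing may be tested on walks.
-- If the first edge (t₁ , s₁) of S splits P into a prefix from s to t₁ and a
-- suffix from s₁ to v, then every walk through S splits the same way, and no
-- edge of S can occur in the prefix of such a walk: all edges of S are
-- reachable from s₁, while every edge of the prefix reaches t₁, which would
-- close a cycle through (t₁ , s₁). So P is the only walk through S exactly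
-- when its prefix is the only walk from s to t₁ and its suffix is the only
-- walk from s₁ to v through the remaining edges; induction on S finishes.
module Submission where

open import Defs
open import Data.Nat using (ℕ)
open import Data.Fin using (Fin; _≟_)
open import Data.List using (List; []; _∷_; _++_)
open import Data.List.Relation.Binary.Sublist.Propositional using (_⊆_; _∷ʳ_; _∷_)
open import Function.Bundles using (_⇔_; mk⇔)

open import Data.Bool using (T)
open import Data.Empty using (⊥-elim)
open import Data.List.Properties
  using (∷-injective; ∷-injectiveʳ; ++-cancelˡ; ++-cancelʳ; ≡-dec)
open import Data.List.Membership.Propositional using (_∈_)
open import Data.List.Membership.Propositional.Properties using (∈-∃++; ∈-++⁻; ∈-++⁺ʳ)
open import Data.List.Relation.Binary.Sublist.Propositional.Properties using (Any-resp-⊆)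
open import Data.List.Relation.Unary.All as All using (All; []; _∷_)
open import Data.List.Relation.Unary.Any using (here; there)
open import Data.List.Relation.Unary.AllPairs using ([]; _∷_)
open import Data.List.Relation.Unary.Unique.Propositional using (Unique)
open import Data.Product using (_×_; _,_; ∃; ∃₂)
open import Data.Product.Function.NonDependent.Propositional using (_×-⇔_)
open import Data.Sum using (inj₁; inj₂)
open import Function.Base using (_∘_)
open import Function.Construct.Composition using (_⇔-∘_)
open import Function.Construct.Symmetry using (⇔-sym)
open import Relation.Binary.PropositionalEquality
  using (_≡_; _≢_; refl; sym; trans; cong; cong₂; subst)
open import Relation.Nullary.Decidable using (decidable-stable)

∷⊆⇒∃++ : ∀ {a} {A : Set a} {x : A} {xs ys} → (x ∷ xs) ⊆ ys
       → ∃₂ λ ys₁ ys₂ → ys ≡ ys₁ ++ x ∷ ys₂ × xs ⊆ ys₂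
∷⊆⇒∃++ (y ∷ʳ τ) with ys₁ , ys₂ , refl , τ′ ← ∷⊆⇒∃++ τ = y ∷ ys₁ , ys₂ , refl , τ′
∷⊆⇒∃++ (refl ∷ τ) = [] , _ , refl , τ

⊆⇒EdgesOn : ∀ {n} {S : List (Edge n)} {P} → S ⊆ edges P → EdgesOn S P
⊆⇒EdgesOn S⊆P = All.tabulate (Any-resp-⊆ S⊆P)

module _ {n : ℕ} (G : Graph n) where

  edges-step : ∀ {x y z vs} → Walk G y z vs → edges (x ∷ vs) ≡ (x , y) ∷ edges vs
  edges-step here       = refl
  edges-step (step _ _) = refl

  walk-++ : ∀ {x t s′ y A B} → Walk G x t A → T (G t s′) → Walk G s′ y B
          → Walk G x y (A ++ B)
  walk-++ here        e wB = step e wB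
  walk-++ (step e′ w) e wB = step e′ (walk-++ w e wB)

  edges-++ : ∀ {x t s′ y A B} → Walk G x t A → Walk G s′ y B
           → edges (A ++ B) ≡ edges A ++ (t , s′) ∷ edges B
  edges-++ here                wB = edges-step wB
  edges-++ (step _ here)       wB = cong (_ ∷_) (edges-++ here wB)
  edges-++ (step _ (step e w)) wB = cong (_ ∷_) (edges-++ (step e w) wB)

  data Decomposition (x a b y : Fin n) : List (Fin n) → List (Edge n) → Set where
    decomposition : ∀ {A B} → Walk G x a A → T (G a b) → Walk G b y B
                  → Decomposition x a b y (A ++ B) (edges B)

  decompose : ∀ {x y a b P} L₁ {L₂} → Walk G x y P → edges P ≡ L₁ ++ (a , b) ∷ L₂
            → Decomposition x a b y P L₂
  decompose []      here ()
  decompose (_ ∷ _) here ()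
  decompose [] (step e w) eq
    with refl , refl ← ∷-injective (trans (sym (edges-step w)) eq) =
    decomposition here e w
  decompose (_ ∷ L₁) (step e w) eq
    with decomposition wA e′ wB ← decompose L₁ w (∷-injectiveʳ (trans (sym (edges-step w)) eq)) =
    decomposition (step e wA) e′ wB

  decompose-∈ : ∀ {x y a b P} → Walk G x y P → (a , b) ∈ edges P
              → ∃ (Decomposition x a b y P)
  decompose-∈ w ab∈P with L₁ , L₂ , eq ← ∈-∃++ ab∈P = L₂ , decompose L₁ w eq

  ∈-walk⇒walk : ∀ {x y z vs} → Walk G y z vs → x ∈ vs → ∃ (Walk G y x)
  ∈-walk⇒walk here       (here refl) = _ , here
  ∈-walk⇒walk (step e w) (here refl) = _ , here
  ∈-walk⇒walk (step e w) (there x∈vs) with _ , w′ ← ∈-walk⇒walk w x∈vs = _ , step e w′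

  WalkForcing : Fin n → Fin n → List (Edge n) → List (Fin n) → Set
  WalkForcing x y S P = ∀ P′ → Walk G x y P′ → EdgesOn S P′ → P′ ≡ P

  EdgesOn-++ : ∀ {x t s′ y A B S} → Walk G x t A → Walk G s′ y B → EdgesOn S B
             → EdgesOn ((t , s′) ∷ S) (A ++ B)
  EdgesOn-++ {A = A} wA wB S⊆B = subst (λ L → All (_∈ L) _) (sym (edges-++ wA wB))
    (∈-++⁺ʳ (edges A) (here refl) ∷ All.map (∈-++⁺ʳ (edges A) ∘ there) S⊆B)

  module _ (acyclic : Acyclic G) where

    walk-unique : ∀ {x y vs} → Walk G x y vs → Unique vs
    walk-unique here = [] ∷ []
    walk-unique (step {x} {y} e w) = All.tabulate x∉ ∷ walk-unique w
      where
      x∉ : ∀ {z} → z ∈ _ → x ≢ z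
      x∉ z∈vs refl with _ , w′ ← ∈-walk⇒walk w z∈vs = acyclic x y _ e w′

    ⇒⇔WalkForcing[] : ∀ {x y P} → Walk G x y P → _⇒_ G x y ⇔ WalkForcing x y [] P
    ⇒⇔WalkForcing[] {P = P} w = mk⇔
      (λ (_ , _ , only) P′ w′ _ →
        trans (only P′ (w′ , walk-unique w′)) (sym (only P (w , walk-unique w))))
      (λ only → P , (w , walk-unique w) , λ P′ (w′ , _) → only P′ w′ [])

    Forcing⇔WalkForcing : ∀ {x y S P} → EdgesOn S P
                        → Forcing G x y S P ⇔ WalkForcing x y S P
    Forcing⇔WalkForcing {P = P} S⊆P = mk⇔
      (λ (_ , forcing) P′ w′ S⊆P′ →
        decidable-stable (≡-dec _≟_ P′ P) λ P′≢P → forcing P′ (w′ , walk-unique w′) P′≢P S⊆P′)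
      (λ only → S⊆P , λ P′ (w′ , _) P′≢P S⊆P′ → P′≢P (only P′ w′ S⊆P′))

    ∈-edges-suffix : ∀ {x t s′ y z a b A B C} → Walk G x t A → T (G t s′) → Walk G s′ y B
                   → Walk G s′ z C → (a , b) ∈ edges C → (a , b) ∈ edges (A ++ B)
                   → (a , b) ∈ edges B
    ∈-edges-suffix {A = A} wA e wB wC ab∈C ab∈AB
      with _ , decomposition s′⇝a ab _ ← decompose-∈ wC ab∈C
         | ∈-++⁻ (edges A) (subst ((_ , _) ∈_) (edges-++ wA wB) ab∈AB)
    ... | inj₁ ab∈A with _ , decomposition _ _ b⇝t ← decompose-∈ wA ab∈A =
      ⊥-elim (acyclic _ _ _ e (walk-++ s′⇝a ab b⇝t))
    ... | inj₂ (here refl) = ⊥-elim (acyclic _ _ _ e s′⇝a)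
    ... | inj₂ (there ab∈B) = ab∈B

    WalkForcing-++ : ∀ {x t s′ y A B S} → Walk G x t A → T (G t s′) → Walk G s′ y B → EdgesOn S B
                   → WalkForcing x y ((t , s′) ∷ S) (A ++ B)
                   ⇔ (WalkForcing x t [] A × WalkForcing s′ y S B)
    WalkForcing-++ {x} {t} {s′} {y} {A} {B} {S} wA e wB S⊆B = mk⇔ split join
      where
      split : WalkForcing x y ((t , s′) ∷ S) (A ++ B)
            → WalkForcing x t [] A × WalkForcing s′ y S B
      split only =
        (λ A′ wA′ _ → ++-cancelʳ B A′ A
          (only (A′ ++ B) (walk-++ wA′ e wB) (EdgesOn-++ wA′ wB S⊆B))) ,
        (λ B′ wB′ S⊆B′ → ++-cancelˡ A B′ B
          (only (A ++ B′) (walk-++ wA e wB′) (EdgesOn-++ wA wB′ S⊆B′)))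

      join : WalkForcing x t [] A × WalkForcing s′ y S B
           → WalkForcing x y ((t , s′) ∷ S) (A ++ B)
      join (onlyA , onlyB) P′ wP′ (ts′∈P′ ∷ S⊆P′)
        with _ , decomposition {B = B′} wA′ _ wB′ ← decompose-∈ wP′ ts′∈P′ =
        cong₂ _++_ (onlyA _ wA′ []) (onlyB _ wB′ S⊆B′)
        where
        S⊆B′ : EdgesOn S B′
        S⊆B′ = All.zipWith (λ (p∈B , p∈P′) → ∈-edges-suffix wA′ e wB′ wB p∈B p∈P′) (S⊆B , S⊆P′)

    WalkForcing⇔Chain : ∀ {x y P} S → Walk G x y P → S ⊆ edges P
                      → WalkForcing x y S P ⇔ Chain G x S y
    WalkForcing⇔Chain [] w _ = ⇔-sym (⇒⇔WalkForcing[] w)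
    WalkForcing⇔Chain ((t , s′) ∷ S) w S⊆P
      with L₁ , L₂ , eq , S⊆L₂ ← ∷⊆⇒∃++ S⊆P
      with decomposition wA e wB ← decompose L₁ w eq =
      (⇔-sym (⇒⇔WalkForcing[] wA) ×-⇔ WalkForcing⇔Chain S wB S⊆L₂)
        ⇔-∘ WalkForcing-++ wA e wB (⊆⇒EdgesOn S⊆L₂)

lemma1 : ∀ {n : ℕ} (G : Graph n) → Acyclic G → (s v : Fin n)
    → (P : List (Fin n)) → DPath G s v P
    → (es : List (Edge n)) → es ⊆ edges P
    → Forcing G s v es P ⇔ Chain G s es v
lemma1 G acyclic s v P (w , _) es es⊆P =
  WalkForcing⇔Chain G acyclic es w es⊆P ⇔-∘ Forcing⇔WalkForcing G acyclic (⊆⇒EdgesOn es⊆P)
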